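{- Let $t$ be a typable unambiguous C-term. Then $t$ has exactly one well-typed completion (hence there is only one choice for $\mathrm{mgen}(t)$).
   Context: Types: fix infinite sets of type variables (tyvars) and term variables, type constructors $\kappa$ with arities, and types $\sigma ::= \alpha \mid \sigma\Rightarrow\tau \mid (\sigma_1,\dots,\sigma_n)\,\kappa$; a set of constants $c$ with assigned types $\mathrm{ctpOf}(c)$. A substitution $\rho$ maps tyvars to types (finite support), $\sigma[\rho]$ its application; $\sigma\le\tau$ iff $\sigma=\tau[\rho]$ for some $\rho$. Maybe-types are types or $\bot$ (absence of annotation). Terms: $t ::= x_\xi \mid c_\xi \mid (t_1\,t_2)_\xi \mid (\lambda x_\xi.\,t)_\zeta$ with $\xi,\zeta$ maybe-types; $t\le s$ iff $t=s[\rho]$ for some $\rho$, where $s[\rho]$ applies $\rho$ to all decorations. A term is unambiguous if no two binders $\lambda x_\xi$, $\lambda x_\zeta$ with the same variable $x$ occur at different positions. An F-term has all decorations types; a C-term has $\bot$ on all application and abstraction nodes and types on all variables, constants and binding variables. Annotation subsumption: $\xi\sqsubseteq\zeta$ iff $\xi\in\{\bot,\zeta\}$, extended structurally to terms ($x_\xi\sqsubseteq x_\zeta$, $c_\xi\sqsubseteq c_\zeta$ iff $\xi\sqsubseteq\zeta$; $(s\,t)_\xi\sqsubseteq(s'\,t')_{\xi'}$ iff componentwise; $(\lambda x_\zeta.t)_\xi\sqsubseteq(\lambda x_{\zeta'}.t')_{\xi'}$ iff componentwise). For an F-term $u$, $\mathrm{tpOf}(u)$ is its top decoration and $\mathrm{FTV}(u)$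 its set of free typed variables $x_\tau$. Well-typedness on F-terms: $\vdash x_\sigma$; $\vdash c_\sigma$ if $\sigma\le\mathrm{ctpOf}(c)$; $\vdash(u\,v)_\sigma$ if $\vdash u$, $\vdash v$, $\mathrm{tpOf}(u)=\mathrm{tpOf}(v)\Rightarrow\sigma$; $\vdash(\lambda x_\sigma.u)_{\sigma\Rightarrow\mathrm{tpOf}(u)}$ if $\vdash u$ and every $x_\tau\in\mathrm{FTV}(u)$ has $\tau=\sigma$. A well-typed completion of $t$ is an F-term $u$ with $t\sqsubseteq u$ and $\vdash u$; $t$ is typable if it has one. A most general well-typed completion of $t$ is a well-typed completion $v$ such that every well-typed completion is $\le v$; $\mathrm{mgen}(t)$ denotes a chosen one (assumed to exist for typable unambiguous terms). -}

module Defs where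

open import Data.Nat using (ℕ; _≤_)
open import Data.Vec using (Vec; []; _∷_)
open import Data.Maybe using (Maybe; just; nothing)
open import Data.List using (List; []; _∷_; _++_)
open import Data.List.Relation.Unary.Unique.Propositional using (Unique)
open import Data.Product using (Σ; ∃; _×_; _,_)
open import Relation.Binary.PropositionalEquality using (_≡_; _≢_)

data Ty (K : Set) (ar : K → ℕ) : Set where
  tv   : ℕ → Ty K ar
  _⇒_  : Ty K ar → Ty K ar → Ty K ar
  con  : (k : K) → Vec (Ty K ar) (ar k) → Ty K ar

record Signature : Set₁ where
  field
    TyCon : Set
    arity : TyCon → ℕ
    Const : Set
    ctpOf : Const → Ty TyCon arity

module _ (S : Signature) where
  open Signature S

  Type : Set
  Type = Ty TyCon arity

  Subst : Set
  Subst = Σ (ℕ → Type) λ ρ → ∃ λ n → ∀ x → n ≤ x → ρ x ≡ tv x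

  mutual
    applyTy : (ℕ → Type) → Type → Type
    applyTy ρ (tv a)    = ρ a
    applyTy ρ (σ ⇒ τ)   = applyTy ρ σ ⇒ applyTy ρ τ
    applyTy ρ (con k σs) = con k (applyTys ρ σs)

    applyTys : ∀ {n} → (ℕ → Type) → Vec Type n → Vec Type n
    applyTys ρ []       = []
    applyTys ρ (σ ∷ σs) = applyTy ρ σ ∷ applyTys ρ σs

  _≤ᵀ_ : Type → Type → Set
  σ ≤ᵀ τ = Σ Subst λ ρ → σ ≡ applyTy (Data.Product.proj₁ ρ) τ

  data Tm (D : Set) : Set where
    var : ℕ → D → Tm D
    cst : Const → D → Tm D
    app : Tm D → Tm D → D → Tm D
    lam : ℕ → D → Tm D → D → Tm D      -- (λ x_ζ. t)_ξ   as  lam x ζ t ξ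

  -- general terms: decorations are maybe-types (nothing = ⊥)
  Term : Set
  Term = Tm (Maybe Type)

  FTerm : Set
  FTerm = Tm Type

  embed : FTerm → Term
  embed (var x σ)     = var x (just σ)
  embed (cst c σ)     = cst c (just σ)
  embed (app u v σ)   = app (embed u) (embed v) (just σ)
  embed (lam x σ u τ) = lam x (just σ) (embed u) (just τ)

  data _⊑ᴹ_ : Maybe Type → Maybe Type → Set where
    ⊥⊑ : ∀ {ζ} → nothing ⊑ᴹ ζ
    refl⊑ : ∀ {ζ} → ζ ⊑ᴹ ζ

  data _⊑_ : Term → Term → Set where
    var⊑ : ∀ {x ξ ζ} → ξ ⊑ᴹ ζ → var x ξ ⊑ var x ζ
    cst⊑ : ∀ {c ξ ζ} → ξ ⊑ᴹ ζ → cst c ξ ⊑ cst c ζ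
    app⊑ : ∀ {s t s' t' ξ ξ'} → s ⊑ s' → t ⊑ t' → ξ ⊑ᴹ ξ' →
           app s t ξ ⊑ app s' t' ξ'
    lam⊑ : ∀ {x ζ ζ' t t' ξ ξ'} → ζ ⊑ᴹ ζ' → t ⊑ t' → ξ ⊑ᴹ ξ' →
           lam x ζ t ξ ⊑ lam x ζ' t' ξ'

  binders : Term → List ℕ
  binders (var x ξ)     = []
  binders (cst c ξ)     = []
  binders (app s t ξ)   = binders s ++ binders t
  binders (lam x ζ t ξ) = x ∷ binders t

  Unambiguous : Term → Set
  Unambiguous t = Unique (binders t)

  data IsC : Term → Set where
    varC : ∀ {x σ} → IsC (var x (just σ))
    cstC : ∀ {c σ} → IsC (cst c (just σ))
    appC : ∀ {s t} → IsC s → IsC t → IsC (app s t nothing)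
    lamC : ∀ {x σ t} → IsC t → IsC (lam x (just σ) t nothing)

  tpOf : FTerm → Type
  tpOf (var x σ)     = σ
  tpOf (cst c σ)     = σ
  tpOf (app u v σ)   = σ
  tpOf (lam x σ u τ) = τ

  data _∈FTV_ : ℕ × Type → FTerm → Set where
    here  : ∀ {x σ} → (x , σ) ∈FTV var x σ
    appˡ  : ∀ {p u v σ} → p ∈FTV u → p ∈FTV app u v σ
    appʳ  : ∀ {p u v σ} → p ∈FTV v → p ∈FTV app u v σ
    under : ∀ {x τ y σ u ρ} → (x , τ) ∈FTV u → x ≢ y →
            (x , τ) ∈FTV lam y σ u ρ

  data ⊢_ : FTerm → Set where
    ⊢var : ∀ {x σ} → ⊢ var x σ
    ⊢cst : ∀ {c σ} → σ ≤ᵀ ctpOf c → ⊢ cst c σ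
    ⊢app : ∀ {u v σ} → ⊢ u → ⊢ v → tpOf u ≡ (tpOf v ⇒ σ) → ⊢ app u v σ
    ⊢lam : ∀ {x σ u} → ⊢ u → (∀ τ → (x , τ) ∈FTV u → τ ≡ σ) →
           ⊢ lam x σ u (σ ⇒ tpOf u)

  Completion : Term → FTerm → Set
  Completion t u = (t ⊑ embed u) × (⊢ u)

  Typable : Term → Set
  Typable t = ∃ λ u → Completion t u

-- In a C-term every variable, constant and binder carries its type, so by induction the
-- completion is forced everywhere: the type of an application node is the codomain of the
-- (already determined) type of its function part, and the type of an abstraction node is
-- fixed by the typing rule for λ.
module Submission where

open import Defs
open import Data.Product using (Σ; _×_; _,_)
open import Relation.Binary.PropositionalEquality using (_≡_; refl; trans; sym)

module _ (S : Signature) where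

  ⇒-injectiveʳ : {σ τ σ′ τ′ : Type S} → (σ ⇒ τ) ≡ (σ′ ⇒ τ′) → τ ≡ τ′
  ⇒-injectiveʳ refl = refl

  completion-unique : {t : Term S} {v w : FTerm S} →
                      IsC S t → Completion S t v → Completion S t w → v ≡ w
  completion-unique {v = var _ _} {w = var _ _} varC
                    (var⊑ refl⊑ , _) (var⊑ refl⊑ , _) = refl
  completion-unique {v = cst _ _} {w = cst _ _} cstC
                    (cst⊑ refl⊑ , _) (cst⊑ refl⊑ , _) = refl
  completion-unique {v = app _ _ _} {w = app _ _ _} (appC s-C r-C)
                    (app⊑ s⊑v₁ r⊑v₂ _ , ⊢app ⊢v₁ ⊢v₂ v₁-type)
                    (app⊑ s⊑w₁ r⊑w₂ _ , ⊢app ⊢w₁ ⊢w₂ w₁-type)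
    with completion-unique s-C (s⊑v₁ , ⊢v₁) (s⊑w₁ , ⊢w₁)
       | completion-unique r-C (r⊑v₂ , ⊢v₂) (r⊑w₂ , ⊢w₂)
  ... | refl | refl with ⇒-injectiveʳ (trans (sym v₁-type) w₁-type)
  ... | refl = refl
  completion-unique {v = lam _ _ _ _} {w = lam _ _ _ _} (lamC r-C)
                    (lam⊑ refl⊑ r⊑v _ , ⊢lam ⊢v _)
                    (lam⊑ refl⊑ r⊑w _ , ⊢lam ⊢w _)
    with completion-unique r-C (r⊑v , ⊢v) (r⊑w , ⊢w)
  ... | refl = refl

proposition1 : (S : Signature) (t : Term S) → IsC S t → Unambiguous S t → Typable S t →
    Σ (FTerm S) (λ u → Completion S t u × ((v : FTerm S) → Completion S t v → v ≡ u))
proposition1 S t t-C _ (u , t↝u) = u , t↝u , λ v t↝v → completion-unique S t-C t↝v t↝u
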